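{- Let $\mathcal{S}$ be a set of positive integers, and let $\mathcal{G}_{\mathcal{S}}$ denote the family of (finite, simple) planar graphs having no cycle whose length lies in $\mathcal{S}$. If $4\notin\mathcal{S}$ and $2k\notin\mathcal{S}$ for some odd integer $k\ge 3$, then there does not exist a constant $C_{\mathcal{S}}$ such that $\chi(G^2)\le\Delta(G)+C_{\mathcal{S}}$ for every $G\in\mathcal{G}_{\mathcal{S}}$.
   Context: The square $G^2$ of a graph $G$ is the graph on $V(G)$ in which two distinct vertices are adjacent if and only if their distance in $G$ is at most $2$. $\chi$ denotes the chromatic number and $\Delta$ the maximum degree. -}

module Defs where

open import Data.Nat using (ℕ; zero; suc; _⊔_)
open import Data.Nat.ListAction using (sum)
open import Data.Empty using (⊥)
open import Data.Bool using (Bool; true; false; if_then_else_)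
open import Data.Fin using (Fin; zero; suc; inject₁; fromℕ)
open import Data.List using (List; map; foldr; allFin)
open import Data.Product using (Σ; _×_; _,_)
open import Data.Sum using (_⊎_)
open import Relation.Binary.PropositionalEquality using (_≡_; _≢_)
open import Relation.Nullary using (¬_)
open import Data.Rational using (ℚ; 0ℚ; 1ℚ) renaming (_+_ to _+ℚ_; _*_ to _*ℚ_; _-_ to _-ℚ_; _≤_ to _≤ℚ_)

record Graph : Set where
  field
    n      : ℕ
    adj    : Fin n → Fin n → Bool
    sym    : ∀ u v → adj u v ≡ adj v u
    irrefl : ∀ v → adj v v ≡ false
open Graph public

Adj : (G : Graph) → Fin (n G) → Fin (n G) → Set
Adj G u v = adj G u v ≡ true

degree : (G : Graph) → Fin (n G) → ℕ
degree G v = sum (map (λ w → if adj G v w then 1 else 0) (allFin (n G)))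

Δ : Graph → ℕ
Δ G = foldr _⊔_ 0 (map (degree G) (allFin (n G)))

Adj² : (G : Graph) → Fin (n G) → Fin (n G) → Set
Adj² G u v = u ≢ v × (Adj G u v ⊎ Σ (Fin (n G)) (λ w → Adj G u w × Adj G w v))

SquareColourable : Graph → ℕ → Set
SquareColourable G m =
  Σ (Fin (n G) → Fin m) (λ c → ∀ u v → Adj² G u v → c u ≢ c v)

HasCycleOfLength : Graph → ℕ → Set
HasCycleOfLength G zero = ⊥
HasCycleOfLength G (suc zero) = ⊥
HasCycleOfLength G (suc (suc zero)) = ⊥
HasCycleOfLength G (suc (suc (suc m))) =
  Σ (Fin (suc (suc (suc m))) → Fin (n G)) λ f →
    (∀ i j → f i ≡ f j → i ≡ j)
    × (∀ (i : Fin (suc (suc m))) → Adj G (f (inject₁ i)) (f (suc i)))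
    × Adj G (f (fromℕ (suc (suc m)))) (f zero)

-- G is planar iff it has a (straight-line) plane drawing:
-- points in ℚ² for the vertices such that no vertex lies on a segment of an
-- edge it is not incident to, and two distinct edges meet only in a common
-- endpoint.  (Equivalent to topological planarity by Fáry's theorem.)
Point : Set
Point = ℚ × ℚ

OnSegment : Point → Point → Point → Set
OnSegment (x , y) (px , py) (qx , qy) =
  Σ ℚ λ t → 0ℚ ≤ℚ t × t ≤ℚ 1ℚ
    × x ≡ px +ℚ t *ℚ (qx -ℚ px) × y ≡ py +ℚ t *ℚ (qy -ℚ py)

SameEdge : {A : Set} → A → A → A → A → Set
SameEdge a b c d = (a ≡ c × b ≡ d) ⊎ (a ≡ d × b ≡ c)

IsPlaneDrawing : (G : Graph) → (Fin (n G) → Point) → Set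
IsPlaneDrawing G p =
  (∀ w a b → Adj G a b → OnSegment (p w) (p a) (p b) → w ≡ a ⊎ w ≡ b)
  × (∀ a b c d → Adj G a b → Adj G c d → ¬ SameEdge a b c d →
       ∀ x → OnSegment x (p a) (p b) → OnSegment x (p c) (p d) →
       Σ (Fin (n G)) λ v → (v ≡ a ⊎ v ≡ b) × (v ≡ c ⊎ v ≡ d) × x ≡ p v)

Planar : Graph → Set
Planar G = Σ (Fin (n G) → Point) (IsPlaneDrawing G)

module Submission where

-- For odd k = 2K₂ + 1 ≥ 3 and any C we build a planar graph whose cycles all
-- have length 4 or 2k, but with χ(G²) > Δ(G) + C.  The graph G K m (K = k - 1)
-- is a k-cycle on "hubs" 0, …, K in which every edge {i, i + 1} is replaced by
-- m paths  hub i – grp i j – hub (i + 1)  of length 2.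
--   * Degrees: hubs have degree 2m, group vertices degree 2, so Δ ≤ 2m.
--   * Colouring: in G² the groups i and i + 1 together form a clique; as k is
--     odd, each colour occurs on at most K₂ of the km group vertices.
--   * Cycles: a cycle alternates between hubs and group vertices, its hubs move
--     ±1 around the k-cycle and, unless its length is 4, never turn back; so it
--     winds around exactly once and has length 2k.
--   * Planarity: an explicit straight-line drawing with rational coordinates,
--     hubs on a vertical axis and the groups fanning out to either side.
-- With m = C K₂ + 1 the colouring bound exceeds 2m + C ≥ Δ + C.

open import Defs hiding (sym)
open import Data.Nat using (ℕ; zero; suc; _+_; _*_; _≤_; _<_; _%_; z≤n; s≤s; NonZero; _≤?_; _<?_; ⌊_/2⌋)
open import Data.Nat.Properties
open import Data.Nat.DivMod
open import Data.Nat.Divisibility using (_∣_; ∣m+n∣m⇒∣n; n∣m*n; m∣m*n; n∣m⇒m%n≡0; ∣⇒≤)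
open import Data.Nat.Tactic.RingSolver using (solve-∀)
import Data.Nat.ListAction as List
open import Data.Fin as Fin using (Fin; zero; suc; toℕ; fromℕ<; fromℕ; inject₁; splitAt; join; remQuot; combine)
import Data.Fin.Properties as Fin
open import Data.Fin.Permutation using (permutation)
open import Data.List using (allFin; map; tabulate)
open import Data.List.Properties using (map-tabulate; foldr-preservesᵇ)
open import Data.List.Relation.Unary.All.Properties using (map⁺; tabulate⁺)
open import Algebra.Properties.CommutativeMonoid.Sum +-0-commutativeMonoid
  using (sum; ∑-comm; ∑-distrib-+; ∑-permute; sum-cong-≗)
open import Data.Rational using (ℚ; 0ℚ; 1ℚ; 1/_; ≢-nonZero; nonNegative)
  renaming (_+_ to _+ℚ_; _*_ to _*ℚ_; _-_ to _-ℚ_; -_ to -ℚ_; _≤_ to _≤ℚ_; _<_ to _<ℚ_; _≟_ to _≟ℚ_;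
            NonZero to NonZeroℚ)
import Data.Rational.Properties as ℚ
open import Data.Rational.Solver using (module +-*-Solver)
open +-*-Solver using (solve; _:+_; _:*_; _:-_; :-_; _:=_; con)
open import Algebra.Properties.Group ℚ.+-0-group using (∙-cancelˡ; x∙y⁻¹≈ε⇒x≈y; ⁻¹-injective; ε⁻¹≈ε)
open import Data.Bool using (Bool; true; false; not; _∨_; if_then_else_)
open import Data.Bool.Properties using (not-involutive; not-injective; not-¬)
open import Data.Sum as Sum using (_⊎_; inj₁; inj₂; swap)
open import Data.Product using (Σ; _×_; _,_; proj₁; proj₂; uncurry)
open import Data.Empty using (⊥-elim)
open import Relation.Nullary using (¬_; yes; no; does)
open import Relation.Binary.PropositionalEquality
open import Function using (_∘_; id)
open import Function.Definitions using (Injective)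

∑-mono : ∀ {n} {f g : Fin n → ℕ} → (∀ i → f i ≤ g i) → sum f ≤ sum g
∑-mono {zero}  f≤g = z≤n
∑-mono {suc n} f≤g = +-mono-≤ (f≤g zero) (∑-mono (f≤g ∘ suc))

∑-const : ∀ n c → sum {n} (λ _ → c) ≡ n * c
∑-const zero    c = refl
∑-const (suc n) c = cong (c +_) (∑-const n c)

∑-bound : ∀ {n} (f : Fin n → ℕ) c → (∀ i → f i ≤ c) → sum f ≤ n * c
∑-bound {n} f c f≤c = subst (sum f ≤_) (∑-const n c) (∑-mono f≤c)

∑-≥-term : ∀ {n} (f : Fin n → ℕ) i → f i ≤ sum f
∑-≥-term f zero    = m≤m+n _ _
∑-≥-term f (suc i) = ≤-trans (∑-≥-term (f ∘ suc) i) (m≤n+m _ _)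

sum-allFin : ∀ {n} (f : Fin n → ℕ) → List.sum (map f (allFin n)) ≡ sum f
sum-allFin f = trans (cong List.sum (map-tabulate id f)) (sum-tabulate f)
  where
  sum-tabulate : ∀ {n} (f : Fin n → ℕ) → List.sum (tabulate f) ≡ sum f
  sum-tabulate {zero}  f = refl
  sum-tabulate {suc n} f = cong (f zero +_) (sum-tabulate (f ∘ suc))

δ : ∀ {n} → Fin n → Fin n → ℕ
δ i j with i Fin.≟ j
... | yes _ = 1
... | no  _ = 0

∑-δ : ∀ {n} (i : Fin n) → sum (δ i) ≡ 1
∑-δ {suc n} zero    = cong suc (trans (sum-cong-≗ {n} (λ _ → refl)) (trans (∑-const n 0) (*-zeroʳ n)))
∑-δ {suc n} (suc i) = trans (sum-cong-≗ δ-suc) (∑-δ i)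
  where
  δ-suc : ∀ j → δ (suc i) (suc j) ≡ δ i j
  δ-suc j with i Fin.≟ j
  ... | yes _ = refl
  ... | no  _ = refl

hits : ∀ {n d} → (Fin n → Fin d) → Fin d → ℕ
hits f γ = sum (λ j → δ (f j) γ)

hits-none : ∀ {n d} (f : Fin n → Fin d) γ → (∀ j → f j ≢ γ) → hits f γ ≡ 0
hits-none {zero}  f γ f≢γ = refl
hits-none {suc n} f γ f≢γ with f zero Fin.≟ γ
... | yes f0≡γ = ⊥-elim (f≢γ zero f0≡γ)
... | no  _    = hits-none (f ∘ suc) γ (f≢γ ∘ suc)

hits-injective : ∀ {n d} (f : Fin n → Fin d) → Injective _≡_ _≡_ f → ∀ γ → hits f γ ≤ 1
hits-injective {zero}  f inj γ = z≤n
hits-injective {suc n} f inj γ with f zero Fin.≟ γ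
... | yes f0≡γ = s≤s (≤-reflexive (hits-none (f ∘ suc) γ
                   (λ j fj≡γ → 0≢1+n (cong toℕ (inj (trans f0≡γ (sym fj≡γ)))))))
... | no  _    = hits-injective (f ∘ suc) (Fin.suc-injective ∘ inj) γ

hits-disjoint : ∀ {n d} (f g : Fin n → Fin d) → Injective _≡_ _≡_ f → Injective _≡_ _≡_ g →
                (∀ i j → f i ≢ g j) → ∀ γ → hits f γ + hits g γ ≤ 1
hits-disjoint f g f-inj g-inj f≢g γ with Fin.any? (λ i → f i Fin.≟ γ)
... | yes (i , fi≡γ) = begin
  hits f γ + hits g γ ≡⟨ cong (hits f γ +_) (hits-none g γ (λ j gj≡γ → f≢g i j (trans fi≡γ (sym gj≡γ)))) ⟩
  hits f γ + 0        ≡⟨ +-identityʳ _ ⟩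
  hits f γ            ≤⟨ hits-injective f f-inj γ ⟩
  1                   ∎
  where open ≤-Reasoning
... | no ∄i = subst (λ c → c + hits g γ ≤ 1) (sym (hits-none f γ (λ i fi≡γ → ∄i (i , fi≡γ))))
                (hits-injective g g-inj γ)

degree-≤-cover : (G : Graph) (v : Fin (n G)) {len : ℕ} (cov : Fin len → Fin (n G)) →
                 (∀ w → Adj G v w → Σ (Fin len) (λ x → cov x ≡ w)) → degree G v ≤ len
degree-≤-cover G v {len} cov covers = begin
  degree G v                                ≡⟨ sum-allFin (adjacent v) ⟩
  sum (adjacent v)                          ≤⟨ ∑-mono adjacent≤hits ⟩
  sum (λ w → sum (λ x → δ (cov x) w))       ≡⟨ ∑-comm (λ w x → δ (cov x) w) ⟩
  sum (λ x → sum (δ (cov x)))               ≡⟨ sum-cong-≗ (∑-δ ∘ cov) ⟩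
  sum {len} (λ _ → 1)                       ≡⟨ ∑-const len 1 ⟩
  len * 1                                   ≡⟨ *-identityʳ len ⟩
  len                                       ∎
  where
  open ≤-Reasoning
  adjacent : Fin (n G) → Fin (n G) → ℕ
  adjacent u w = if adj G u w then 1 else 0
  adjacent≤hits : ∀ w → adjacent v w ≤ hits cov w
  adjacent≤hits w with adj G v w in v~w
  ... | false = z≤n
  ... | true with covers w v~w
  ... | x , cov-x≡w = ≤-trans (≤-reflexive (sym δ≡1)) (∑-≥-term (λ y → δ (cov y) w) x)
    where
    δ≡1 : δ (cov x) w ≡ 1
    δ≡1 with cov x Fin.≟ w
    ... | yes _ = refl
    ... | no cov-x≢w = ⊥-elim (cov-x≢w cov-x≡w)

Δ-≤ : (G : Graph) (B : ℕ) → (∀ v → degree G v ≤ B) → Δ G ≤ B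
Δ-≤ G B deg≤B = foldr-preservesᵇ {P = _≤ B} ⊔-lub z≤n (map⁺ (tabulate⁺ deg≤B))

parity : ∀ n → Σ ℕ λ s → n ≡ s + s ⊎ n ≡ suc (s + s)
parity zero = 0 , inj₁ refl
parity (suc n) with parity n
... | s , inj₁ n≡2s  = s , inj₂ (cong suc n≡2s)
... | s , inj₂ n≡2s+1 = suc s , inj₁ (trans (cong suc n≡2s+1) (sym (+-suc (suc s) s)))

alternating : (f : ℕ → Bool) → (∀ t → f (suc t) ≡ not (f t)) →
              ∀ s → f (s + s) ≡ f 0 × f (suc (s + s)) ≡ not (f 0)
alternating f flips zero    = refl , flips 0
alternating f flips (suc s) = even , trans (flips (suc s + suc s)) (cong not even)
  where
  even : f (suc s + suc s) ≡ f 0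
  even = begin
    f (suc s + suc s)        ≡⟨ cong (f ∘ suc) (+-suc s s) ⟩
    f (suc (suc (s + s)))    ≡⟨ flips (suc (s + s)) ⟩
    not (f (suc (s + s)))    ≡⟨ cong not (proj₂ (alternating f flips s)) ⟩
    not (not (f 0))          ≡⟨ not-involutive (f 0) ⟩
    f 0                      ∎
    where open ≡-Reasoning

double-+ : ∀ d s → (d + s) + (d + s) ≡ (s + s) + (d + d)
double-+ = solve-∀

double≢odd : ∀ a b → a + a ≢ suc (b + b)
double≢odd a b eq = even≢odd a b (begin
  a + (a + 0)      ≡⟨ cong (a +_) (+-identityʳ a) ⟩
  a + a            ≡⟨ eq ⟩
  suc (b + b)      ≡⟨ cong (λ x → suc (b + x)) (+-identityʳ b) ⟨
  suc (b + (b + 0)) ∎)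
  where open ≡-Reasoning

half-injective : ∀ a b → a + a ≡ b + b → a ≡ b
half-injective a b eq = trans (n≡⌊n+n/2⌋ a) (trans (cong ⌊_/2⌋ eq) (sym (n≡⌊n+n/2⌋ b)))

halve : ∀ {c} K₂ → c + c ≤ suc (K₂ + K₂) → c ≤ K₂
halve {c} K₂ 2c≤ with c ≤? K₂
... | yes c≤K₂ = c≤K₂
... | no  c≰K₂ = ⊥-elim (<⇒≱ (≤-trans (≤-reflexive (cong suc (sym (+-suc K₂ K₂))))
                                      (+-mono-≤ (≰⇒> c≰K₂) (≰⇒> c≰K₂))) 2c≤)


[m%n+o]%n≡[m+o]%n : ∀ m o L .{{_ : NonZero L}} → (m % L + o) % L ≡ (m + o) % L
[m%n+o]%n≡[m+o]%n m o L = begin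
  (m % L + o) % L         ≡⟨ %-distribˡ-+ (m % L) o L ⟩
  (m % L % L + o % L) % L ≡⟨ cong (λ r → (r + o % L) % L) (m%n%n≡m%n m L) ⟩
  (m % L + o % L) % L     ≡⟨ %-distribˡ-+ m o L ⟨
  (m + o) % L             ∎
  where open ≡-Reasoning

%-invariant⇒∣ : ∀ x d L .{{_ : NonZero L}} → (x + d) % L ≡ x % L → L ∣ d
%-invariant⇒∣ x d L same = ∣m+n∣m⇒∣n (subst (L ∣_) q₁L≡q₀L+d (n∣m*n q₁)) (n∣m*n q₀)
  where
  q₀ q₁ : ℕ
  q₀ = x / L
  q₁ = (x + d) / L
  q₁L≡q₀L+d : q₁ * L ≡ q₀ * L + d
  q₁L≡q₀L+d = +-cancelˡ-≡ (x % L) _ _ (begin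
    x % L + q₁ * L         ≡⟨ cong (_+ q₁ * L) same ⟨
    (x + d) % L + q₁ * L   ≡⟨ m≡m%n+[m/n]*n (x + d) L ⟨
    x + d                  ≡⟨ cong (_+ d) (m≡m%n+[m/n]*n x L) ⟩
    x % L + q₀ * L + d     ≡⟨ +-assoc (x % L) _ d ⟩
    x % L + (q₀ * L + d)   ∎)
    where open ≡-Reasoning

module Cyclic (K : ℕ) where

  k : ℕ
  k = suc K

  shift : ℕ → Fin k → Fin k
  shift d i = (toℕ i + d) mod k

  toℕ-shift : ∀ d i → toℕ (shift d i) ≡ (toℕ i + d) % k
  toℕ-shift d i = Fin.toℕ-fromℕ< _

  shift-shift : ∀ d e i → shift e (shift d i) ≡ shift (d + e) i
  shift-shift d e i = Fin.toℕ-injective (begin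
    toℕ (shift e (shift d i))  ≡⟨ toℕ-shift e (shift d i) ⟩
    (toℕ (shift d i) + e) % k  ≡⟨ cong (λ r → (r + e) % k) (toℕ-shift d i) ⟩
    ((toℕ i + d) % k + e) % k  ≡⟨ [m%n+o]%n≡[m+o]%n (toℕ i + d) e k ⟩
    (toℕ i + d + e) % k        ≡⟨ cong (_% k) (+-assoc (toℕ i) d e) ⟩
    (toℕ i + (d + e)) % k      ≡⟨ toℕ-shift (d + e) i ⟨
    toℕ (shift (d + e) i)      ∎)
    where open ≡-Reasoning

  shift-multiple : ∀ q i → shift (q * k) i ≡ i
  shift-multiple q i = Fin.toℕ-injective (begin
    toℕ (shift (q * k) i)  ≡⟨ toℕ-shift (q * k) i ⟩
    (toℕ i + q * k) % k    ≡⟨ [m+kn]%n≡m%n (toℕ i) q k ⟩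
    toℕ i % k              ≡⟨ m<n⇒m%n≡m (Fin.toℕ<n i) ⟩
    toℕ i                  ∎)
    where open ≡-Reasoning

  shift-fixed⇒∣ : ∀ d i → shift d i ≡ i → k ∣ d
  shift-fixed⇒∣ d i fixed = %-invariant⇒∣ (toℕ i) d k (begin
    (toℕ i + d) % k  ≡⟨ toℕ-shift d i ⟨
    toℕ (shift d i)  ≡⟨ cong toℕ fixed ⟩
    toℕ i            ≡⟨ m<n⇒m%n≡m (Fin.toℕ<n i) ⟨
    toℕ i % k        ∎)
    where open ≡-Reasoning

  next prev : Fin k → Fin k
  next = shift 1
  prev = shift K

  shift-k : ∀ i → shift k i ≡ i
  shift-k i = trans (cong (λ d → shift d i) (sym (*-identityˡ k))) (shift-multiple 1 i)

  prev-next : ∀ i → prev (next i) ≡ i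
  prev-next i = trans (shift-shift 1 K i) (shift-k i)

  next-prev : ∀ i → next (prev i) ≡ i
  next-prev i = trans (shift-shift K 1 i) (trans (cong (λ d → shift d i) (+-comm K 1)) (shift-k i))

  next≢id : 1 ≤ K → ∀ i → next i ≢ i
  next≢id 1≤K i fixed = <⇒≱ (s≤s 1≤K) (∣⇒≤ (shift-fixed⇒∣ 1 i fixed))

  ∑-next : (f : Fin k → ℕ) → sum (f ∘ next) ≡ sum f
  ∑-next f = sym (∑-permute f (permutation next prev next-prev prev-next))

  -- The steps 1 and K ≡ -1 are units modulo k: k ∣ q d forces k ∣ q.
  ∣-direction : ∀ {d} q → d ≡ 1 ⊎ d ≡ K → k ∣ q * d → k ∣ q
  ∣-direction q (inj₁ refl) k∣q = subst (k ∣_) (*-identityʳ q) k∣q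
  ∣-direction q (inj₂ refl) k∣qK =
    ∣m+n∣m⇒∣n (subst (k ∣_) (trans (*-suc q K) (+-comm q (q * K))) (n∣m*n q)) k∣qK

  toℕ-next-< : ∀ i → toℕ i < K → toℕ (next i) ≡ suc (toℕ i)
  toℕ-next-< i i<K = trans (toℕ-shift 1 i) (trans (cong (_% k) (+-comm (toℕ i) 1)) (m<n⇒m%n≡m (s≤s i<K)))

  toℕ-next-last : ∀ i → toℕ i ≡ K → toℕ (next i) ≡ 0
  toℕ-next-last i i≡K = trans (toℕ-shift 1 i) (trans (cong (λ a → (a + 1) % k) i≡K)
                          (trans (cong (_% k) (+-comm K 1)) (n%n≡0 k)))

-- A cycle of length L read periodically: a closed walk whose exact period is L.
record CyclicWalk (G : Graph) (L : ℕ) : Set where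
  field
    at        : ℕ → Fin (n G)
    step      : ∀ t → Adj G (at t) (at (suc t))
    periodic  : ∀ t → at (t + L) ≡ at t
    return⇒∣ : ∀ t d → at (t + d) ≡ at t → L ∣ d

later : ∀ {G L} → CyclicWalk G L → CyclicWalk G L
later W = record
  { at        = at ∘ suc
  ; step      = step ∘ suc
  ; periodic  = periodic ∘ suc
  ; return⇒∣ = return⇒∣ ∘ suc
  }
  where open CyclicWalk W

toℕ-mod : ∀ t L .{{_ : NonZero L}} → toℕ (t mod L) ≡ t % L
toℕ-mod t L = Fin.toℕ-fromℕ< _

suc-% : ∀ t L .{{_ : NonZero L}} → suc t % L ≡ suc (t % L) % L
suc-% t L = trans (cong (_% L) (+-comm 1 t))
                  (trans (sym ([m%n+o]%n≡[m+o]%n t 1 L)) (cong (_% L) (+-comm (t % L) 1)))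

mod-suc : ∀ n t → (Σ (Fin n) λ i → t mod suc n ≡ inject₁ i × suc t mod suc n ≡ suc i)
                  ⊎ (t mod suc n ≡ fromℕ n × suc t mod suc n ≡ zero)
mod-suc n t with suc (t % suc n) <? suc n
... | yes t⁺<L = inj₁ (i , t≡ , t⁺≡)
  where
  i : Fin n
  i = fromℕ< (≤-pred t⁺<L)
  t≡ : t mod suc n ≡ inject₁ i
  t≡ = Fin.toℕ-injective (trans (toℕ-mod t (suc n)) (sym (trans (Fin.toℕ-inject₁ i) (Fin.toℕ-fromℕ< _))))
  t⁺≡ : suc t mod suc n ≡ suc i
  t⁺≡ = Fin.toℕ-injective (trans (toℕ-mod (suc t) (suc n)) (trans (suc-% t (suc n))
          (trans (m<n⇒m%n≡m t⁺<L) (sym (cong suc (Fin.toℕ-fromℕ< _))))))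
... | no t⁺≮L = inj₂ (t≡ , t⁺≡)
  where
  t⁺≡L : suc (t % suc n) ≡ suc n
  t⁺≡L = ≤-antisym (m%n<n t (suc n)) (≮⇒≥ t⁺≮L)
  t≡ : t mod suc n ≡ fromℕ n
  t≡ = Fin.toℕ-injective (trans (toℕ-mod t (suc n)) (trans (suc-injective t⁺≡L) (sym (Fin.toℕ-fromℕ n))))
  t⁺≡ : suc t mod suc n ≡ zero
  t⁺≡ = Fin.toℕ-injective (trans (toℕ-mod (suc t) (suc n))
          (trans (suc-% t (suc n)) (trans (cong (_% suc n) t⁺≡L) (n%n≡0 (suc n)))))

cycle⇒walk : ∀ G L → HasCycleOfLength G L → CyclicWalk G L
cycle⇒walk G (suc (suc (suc r))) (f , f-injective , f-step , f-close) = record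
  { at        = at
  ; step      = step
  ; periodic  = λ t → cong f (Fin.toℕ-injective (begin
      toℕ ((t + L) mod L)  ≡⟨ toℕ-mod (t + L) L ⟩
      (t + L) % L          ≡⟨ [m+n]%n≡m%n t L ⟩
      t % L                ≡⟨ toℕ-mod t L ⟨
      toℕ (t mod L)        ∎))
  ; return⇒∣ = λ t d same → %-invariant⇒∣ t d L (begin
      (t + d) % L          ≡⟨ toℕ-mod (t + d) L ⟨
      toℕ ((t + d) mod L)  ≡⟨ cong toℕ (f-injective _ _ same) ⟩
      toℕ (t mod L)        ≡⟨ toℕ-mod t L ⟩
      t % L                ∎)
  }
  where
  open ≡-Reasoning
  L : ℕ
  L = 3 + r

  at : ℕ → Fin (n G)
  at t = f (t mod L)

  step : ∀ t → Adj G (at t) (at (suc t))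
  step t with mod-suc (2 + r) t
  ... | inj₁ (i , t≡ , t⁺≡) = subst₂ (λ x y → Adj G (f x) (f y)) (sym t≡) (sym t⁺≡) (f-step i)
  ... | inj₂ (t≡ , t⁺≡)     = subst₂ (λ x y → Adj G (f x) (f y)) (sym t≡) (sym t⁺≡) f-close

module Construction (K m : ℕ) where
  open Cyclic K public

  data V : Set where
    hub : Fin k → V
    grp : Fin k → Fin m → V

  end : Bool → Fin k → Fin k
  end false i = i
  end true  i = next i

  isEnd : Fin k → Fin k → Bool
  isEnd h i = does (h Fin.≟ i) ∨ does (h Fin.≟ next i)

  isEnd-sound : ∀ h i → isEnd h i ≡ true → Σ Bool λ e → h ≡ end e i
  isEnd-sound h i h∈i with h Fin.≟ i | h Fin.≟ next i
  ... | yes h≡i | _        = false , h≡i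
  ... | no _    | yes h≡i⁺ = true , h≡i⁺

  isEnd-complete : ∀ e i → isEnd (end e i) i ≡ true
  isEnd-complete false i with i Fin.≟ i
  ... | yes _  = refl
  ... | no i≢i = ⊥-elim (i≢i refl)
  isEnd-complete true i with next i Fin.≟ i | next i Fin.≟ next i
  ... | yes _ | _       = refl
  ... | no _  | yes _   = refl
  ... | no _  | no i≢i  = ⊥-elim (i≢i refl)

  adjV : V → V → Bool
  adjV (hub _)   (hub _)   = false
  adjV (hub h)   (grp i _) = isEnd h i
  adjV (grp i _) (hub h)   = isEnd h i
  adjV (grp _ _) (grp _ _) = false

  adjV-sym : ∀ u v → adjV u v ≡ adjV v u
  adjV-sym (hub _)   (hub _)   = refl
  adjV-sym (hub _)   (grp _ _) = refl
  adjV-sym (grp _ _) (hub _)   = refl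
  adjV-sym (grp _ _) (grp _ _) = refl

  adjV-irrefl : ∀ v → adjV v v ≡ false
  adjV-irrefl (hub _)   = refl
  adjV-irrefl (grp _ _) = refl

  N : ℕ
  N = k + k * m

  fromSum : Fin k ⊎ Fin (k * m) → V
  fromSum (inj₁ h) = hub h
  fromSum (inj₂ x) = uncurry grp (remQuot m x)

  toV : Fin N → V
  toV = fromSum ∘ splitAt k

  fromV : V → Fin N
  fromV (hub h)   = join k (k * m) (inj₁ h)
  fromV (grp i j) = join k (k * m) (inj₂ (combine i j))

  toV-fromV : ∀ v → toV (fromV v) ≡ v
  toV-fromV (hub h)   = cong fromSum (Fin.splitAt-join k (k * m) (inj₁ h))
  toV-fromV (grp i j) = trans (cong fromSum (Fin.splitAt-join k (k * m) (inj₂ (combine i j))))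
                              (cong (uncurry grp) (Fin.remQuot-combine i j))

  fromV-toV : ∀ x → fromV (toV x) ≡ x
  fromV-toV x with splitAt k x in split
  ... | inj₁ h = trans (cong (join k (k * m)) (sym split)) (Fin.join-splitAt k (k * m) x)
  ... | inj₂ y = trans (cong (λ z → join k (k * m) (inj₂ z)) (Fin.combine-remQuot {k} m y))
                       (trans (cong (join k (k * m)) (sym split)) (Fin.join-splitAt k (k * m) x))

  toV-injective : Injective _≡_ _≡_ toV
  toV-injective {x} {y} eq = trans (sym (fromV-toV x)) (trans (cong fromV eq) (fromV-toV y))

  fromV-injective : Injective _≡_ _≡_ fromV
  fromV-injective {u} {v} eq = trans (sym (toV-fromV u)) (trans (cong toV eq) (toV-fromV v))

  toV⁻¹ : ∀ {x v} → toV x ≡ v → fromV v ≡ x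
  toV⁻¹ {x} refl = fromV-toV x

  G : Graph
  G = record
    { n      = N
    ; adj    = λ x y → adjV (toV x) (toV y)
    ; sym    = λ x y → adjV-sym (toV x) (toV y)
    ; irrefl = λ x → adjV-irrefl (toV x)
    }

  adjacent : ∀ u v → adjV u v ≡ true → Adj G (fromV u) (fromV v)
  adjacent u v = subst₂ (λ u′ v′ → adjV u′ v′ ≡ true) (sym (toV-fromV u)) (sym (toV-fromV v))

  hubNeighbour′ : Fin k → Fin m ⊎ Fin m → Fin N
  hubNeighbour′ h (inj₁ j) = fromV (grp h j)
  hubNeighbour′ h (inj₂ j) = fromV (grp (prev h) j)

  hubNeighbour : Fin k → Fin (m + m) → Fin N
  hubNeighbour h = hubNeighbour′ h ∘ splitAt m

  hubNeighbour-onto : ∀ h w → adjV (hub h) w ≡ true → Σ (Fin (m + m)) λ y → hubNeighbour h y ≡ fromV w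
  hubNeighbour-onto h (grp i j) h∈i with isEnd-sound h i h∈i
  ... | false , refl = join m m (inj₁ j) , cong (hubNeighbour′ h) (Fin.splitAt-join m m (inj₁ j))
  ... | true  , refl = join m m (inj₂ j) , trans (cong (hubNeighbour′ h) (Fin.splitAt-join m m (inj₂ j)))
                                                 (cong (λ i′ → fromV (grp i′ j)) (prev-next i))

  grpNeighbour : Fin k → Fin 2 → Fin N
  grpNeighbour i zero    = fromV (hub i)
  grpNeighbour i (suc _) = fromV (hub (next i))

  grpNeighbour-onto : ∀ i j w → adjV (grp i j) w ≡ true → Σ (Fin 2) λ y → grpNeighbour i y ≡ fromV w
  grpNeighbour-onto i j (hub h) h∈i with isEnd-sound h i h∈i
  ... | false , refl = zero , refl
  ... | true  , refl = suc zero , refl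

  degree-≤-onto : ∀ {len} (nb : Fin len → Fin N) x {v} → toV x ≡ v →
                  (∀ w → adjV v w ≡ true → Σ (Fin len) λ y → nb y ≡ fromV w) → degree G x ≤ len
  degree-≤-onto nb x refl onto = degree-≤-cover G x nb λ w x~w →
    let y , nb-y≡w = onto (toV w) x~w in y , trans nb-y≡w (fromV-toV w)

  Δ-G : 1 ≤ m → Δ G ≤ m + m
  Δ-G 1≤m = Δ-≤ G (m + m) (λ x → degree-≤ x (toV x) refl)
    where
    degree-≤ : ∀ x v → toV x ≡ v → degree G x ≤ m + m
    degree-≤ x (hub h)   x≡v = degree-≤-onto (hubNeighbour h) x x≡v (hubNeighbour-onto h)
    degree-≤ x (grp i j) x≡v =
      ≤-trans (degree-≤-onto (grpNeighbour i) x x≡v (grpNeighbour-onto i j)) (+-mono-≤ 1≤m 1≤m)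

  grp-injectiveˡ : ∀ {i i′ j j′} → grp i j ≡ grp i′ j′ → i ≡ i′
  grp-injectiveˡ refl = refl

  grp-injectiveʳ : ∀ {i i′ j j′} → grp i j ≡ grp i′ j′ → j ≡ j′
  grp-injectiveʳ refl = refl

  common-hub : ∀ u v h → u ≢ v → adjV u (hub h) ≡ true → adjV (hub h) v ≡ true →
               Adj² G (fromV u) (fromV v)
  common-hub u v h u≢v u~h h~v =
    u≢v ∘ fromV-injective , inj₂ (fromV (hub h) , adjacent u (hub h) u~h , adjacent (hub h) v h~v)

  module GroupColouring (1≤K : 1 ≤ K) {D : ℕ} (c : Fin N → Fin D)
                        (proper : ∀ x y → Adj² G x y → c x ≢ c y) where

    colour : Fin k → Fin m → Fin D
    colour i j = c (fromV (grp i j))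

    colour-injective : ∀ i → Injective _≡_ _≡_ (colour i)
    colour-injective i {j} {j′} same with j Fin.≟ j′
    ... | yes j≡j′ = j≡j′
    ... | no  j≢j′ = ⊥-elim (proper _ _ (common-hub (grp i j) (grp i j′) i (j≢j′ ∘ grp-injectiveʳ)
                       (isEnd-complete false i) (isEnd-complete false i)) same)

    colour-next : ∀ i j j′ → colour i j ≢ colour (next i) j′
    colour-next i j j′ = proper _ _ (common-hub (grp i j) (grp (next i) j′) (next i)
      (next≢id 1≤K i ∘ sym ∘ grp-injectiveˡ) (isEnd-complete true i) (isEnd-complete false (next i)))

    used : Fin D → Fin k → ℕ
    used γ i = hits (colour i) γ

    all-used : sum (λ γ → sum (used γ)) ≡ k * m
    all-used = begin
      sum (λ γ → sum (λ i → sum (λ j → δ (colour i j) γ)))   ≡⟨ ∑-comm (λ γ i → used γ i) ⟩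
      sum (λ i → sum (λ γ → sum (λ j → δ (colour i j) γ)))   ≡⟨ sum-cong-≗ (λ i → ∑-comm (λ γ j → δ (colour i j) γ)) ⟩
      sum (λ i → sum (λ j → sum (δ (colour i j))))           ≡⟨ sum-cong-≗ (λ i → sum-cong-≗ (λ j → ∑-δ (colour i j))) ⟩
      sum {k} (λ _ → sum {m} (λ _ → 1))                      ≡⟨ sum-cong-≗ {k} (λ _ → trans (∑-const m 1) (*-identityʳ m)) ⟩
      sum {k} (λ _ → m)                                      ≡⟨ ∑-const k m ⟩
      k * m                                                  ∎
      where open ≡-Reasoning

    -- Two consecutive groups use γ at most once together, and the k pairs of
    -- consecutive groups count every group twice.
    used-twice : ∀ γ → sum (used γ) + sum (used γ) ≤ k
    used-twice γ = begin
      sum (used γ) + sum (used γ)             ≡⟨ cong (sum (used γ) +_) (∑-next (used γ)) ⟨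
      sum (used γ) + sum (used γ ∘ next)      ≡⟨ ∑-distrib-+ (used γ) (used γ ∘ next) ⟨
      sum (λ i → used γ i + used γ (next i))  ≤⟨ ∑-bound _ 1 (λ i → hits-disjoint (colour i) (colour (next i))
                                                  (colour-injective i) (colour-injective (next i)) (colour-next i) γ) ⟩
      k * 1                                   ≡⟨ *-identityʳ k ⟩
      k                                       ∎
      where open ≤-Reasoning

  -- If k = 2K₂ + 1, every colour of G² is used on at most K₂ group vertices,
  -- so the km group vertices need at least km / K₂ colours.
  square-colouring-bound : 1 ≤ K → ∀ K₂ → K ≡ K₂ + K₂ → ∀ D → SquareColourable G D → k * m ≤ D * K₂
  square-colouring-bound 1≤K K₂ K≡2K₂ D (c , proper) = begin
    k * m                      ≡⟨ all-used ⟨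
    sum (λ γ → sum (used γ))   ≤⟨ ∑-bound _ K₂ (λ γ → halve K₂ (subst (sum (used γ) + sum (used γ) ≤_) (cong suc K≡2K₂) (used-twice γ))) ⟩
    D * K₂                     ∎
    where
    open ≤-Reasoning
    open GroupColouring 1≤K c proper

module CycleLengths (K m : ℕ) (1≤K : 1 ≤ K) where
  open Construction K m

  isHub : V → Bool
  isHub (hub _)   = true
  isHub (grp _ _) = false

  -- G is bipartite with parts hubs / group vertices.
  isHub-flips : ∀ u v → adjV u v ≡ true → isHub v ≡ not (isHub u)
  isHub-flips (hub _)   (grp _ _) _ = refl
  isHub-flips (grp _ _) (hub _)   _ = refl
  isHub-flips (hub _)   (hub _)   ()
  isHub-flips (grp _ _) (grp _ _) ()

  hub-view : ∀ v → isHub v ≡ true → Σ (Fin k) λ h → v ≡ hub h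
  hub-view (hub h)   _  = h , refl
  hub-view (grp _ _) ()

  hub-injective : ∀ {h h′} → hub h ≡ hub h′ → h ≡ h′
  hub-injective refl = refl

  grp-view : ∀ v → isHub v ≡ false → Σ (Fin k) λ i → Σ (Fin m) λ j → v ≡ grp i j
  grp-view (hub _)   ()
  grp-view (grp i j) _  = i , j , refl

  -- A cyclic walk of length L ≥ 3 starting at a hub.  H s is the hub visited
  -- at time 2s; consecutive hubs are neighbours on the underlying k-cycle.
  module HubWalk {L : ℕ} (3≤L : 3 ≤ L) (W : CyclicWalk G L)
                 (starts-at-hub : isHub (toV (CyclicWalk.at W 0)) ≡ true) where
    open CyclicWalk W

    w : ℕ → V
    w t = toV (at t)

    kinds : ∀ s → isHub (w (s + s)) ≡ true × isHub (w (suc (s + s))) ≡ false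
    kinds s =
      let even , odd = alternating (isHub ∘ w) (λ t → isHub-flips (w t) (w (suc t)) (step t)) s
      in trans even starts-at-hub , trans odd (cong not starts-at-hub)

    H : ℕ → Fin k
    H s = proj₁ (hub-view (w (s + s)) (proj₁ (kinds s)))

    w-even : ∀ s → w (s + s) ≡ hub (H s)
    w-even s = proj₂ (hub-view (w (s + s)) (proj₁ (kinds s)))

    L-even : Σ ℕ λ L′ → L ≡ L′ + L′
    L-even with parity L
    ... | L′ , inj₁ L≡2L′   = L′ , L≡2L′
    ... | L′ , inj₂ L≡2L′+1 = ⊥-elim (not-¬ refl (begin
      true                       ≡⟨ proj₁ (kinds 0) ⟨
      isHub (w 0)                ≡⟨ cong (isHub ∘ toV) (periodic 0) ⟨
      isHub (w L)                ≡⟨ cong (isHub ∘ w) L≡2L′+1 ⟩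
      isHub (w (suc (L′ + L′)))  ≡⟨ proj₂ (kinds L′) ⟩
      false                      ∎))
      where open ≡-Reasoning

    H-return : ∀ s d → H (d + s) ≡ H s → L ∣ d + d
    H-return s d same = return⇒∣ (s + s) (d + d) (toV-injective (begin
      w (s + s + (d + d))  ≡⟨ cong w (double-+ d s) ⟨
      w (d + s + (d + s))  ≡⟨ w-even (d + s) ⟩
      hub (H (d + s))      ≡⟨ cong hub same ⟩
      hub (H s)            ≡⟨ w-even s ⟨
      w (s + s)            ∎))
      where open ≡-Reasoning

    -- A cycle has length at least 3, so it cannot return after a single hub-step.
    L∤2 : ¬ L ∣ 2
    L∤2 L∣2 = <⇒≱ 3≤L (∣⇒≤ L∣2)

    around-group : ∀ s → Σ (Fin k) λ i → (Σ Bool λ e → H s ≡ end e i) × (Σ Bool λ e → H (suc s) ≡ end e i)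
    around-group s with grp-view (w (suc (s + s))) (proj₂ (kinds s))
    ... | i , j , w-odd = i , isEnd-sound (H s) i before , isEnd-sound (H (suc s)) i after
      where
      before : adjV (hub (H s)) (grp i j) ≡ true
      before = subst₂ (λ u v → adjV u v ≡ true) (w-even s) w-odd (step (s + s))
      after : adjV (grp i j) (hub (H (suc s))) ≡ true
      after = subst₂ (λ u v → adjV u v ≡ true) w-odd
                (trans (cong w (sym (cong suc (+-suc s s)))) (w-even (suc s))) (step (suc (s + s)))

    H-moves : ∀ s → H (suc s) ≡ next (H s) ⊎ H (suc s) ≡ prev (H s)
    H-moves s with around-group s
    ... | i , (false , H≡i)  , (true  , H⁺≡i⁺) = inj₁ (trans H⁺≡i⁺ (cong next (sym H≡i)))
    ... | i , (true  , H≡i⁺) , (false , H⁺≡i)  = inj₂ (trans H⁺≡i (trans (sym (prev-next i)) (cong prev (sym H≡i⁺))))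
    ... | i , (false , H≡i)  , (false , H⁺≡i)  = ⊥-elim (L∤2 (H-return s 1 (trans H⁺≡i (sym H≡i))))
    ... | i , (true  , H≡i⁺) , (true  , H⁺≡i⁺) = ⊥-elim (L∤2 (H-return s 1 (trans H⁺≡i⁺ (sym H≡i⁺))))

    L∣4⇒L≡4 : L ∣ 4 → L ≡ 4
    L∣4⇒L≡4 L∣4 with m≤n⇒m<n∨m≡n (∣⇒≤ L∣4)
    ... | inj₂ L≡4 = L≡4
    ... | inj₁ L<4 with ≤-antisym (≤-pred L<4) 3≤L
    ... | refl with n∣m⇒m%n≡0 4 3 L∣4
    ... | ()

    -- If the first step goes in direction d, so do all steps (d′ is the opposite direction).
    steady : L ≢ 4 → ∀ d d′ → (∀ h → shift d′ (shift d h) ≡ h) →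
             (∀ s → H (suc s) ≡ shift d (H s) ⊎ H (suc s) ≡ shift d′ (H s)) →
             H 1 ≡ shift d (H 0) → ∀ s → H (suc s) ≡ shift d (H s)
    steady L≢4 d d′ back moves first zero = first
    steady L≢4 d d′ back moves first (suc s) with moves (suc s)
    ... | inj₁ forward = forward
    ... | inj₂ turn = ⊥-elim (L≢4 (L∣4⇒L≡4 (H-return s 2 (begin
      H (2 + s)                 ≡⟨ turn ⟩
      shift d′ (H (suc s))      ≡⟨ cong (shift d′) (steady L≢4 d d′ back moves first s) ⟩
      shift d′ (shift d (H s))  ≡⟨ back (H s) ⟩
      H s                       ∎))))
      where open ≡-Reasoning

    orbit : ∀ d → (∀ s → H (suc s) ≡ shift d (H s)) → ∀ s → H s ≡ shift (s * d) (H 0)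
    orbit d moves zero    = sym (shift-multiple 0 (H 0))
    orbit d moves (suc s) = begin
      H (suc s)                      ≡⟨ moves s ⟩
      shift d (H s)                  ≡⟨ cong (shift d) (orbit d moves s) ⟩
      shift d (shift (s * d) (H 0))  ≡⟨ shift-shift (s * d) d (H 0) ⟩
      shift (s * d + d) (H 0)        ≡⟨ cong (λ e → shift e (H 0)) (+-comm (s * d) d) ⟩
      shift (suc s * d) (H 0)        ∎
      where open ≡-Reasoning

    -- Going around in a fixed direction d ∈ {1, K}, the walk closes up after
    -- L/2 hub-steps, which must therefore be a multiple of k; conversely it
    -- returns to its start after k hub-steps, so L divides 2k.  Hence L = 2k.
    closes : ∀ d → d ≡ 1 ⊎ d ≡ K → (∀ s → H (suc s) ≡ shift d (H s)) → L ≡ k + k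
    closes d d∈ moves with L-even
    ... | zero , L≡0 = ⊥-elim (<⇒≱ 3≤L (subst (_≤ 2) (sym L≡0) z≤n))
    ... | suc L″ , L≡2L′ = ≤-antisym L≤2k 2k≤L
      where
      L′ : ℕ
      L′ = suc L″
      H-L′ : H L′ ≡ H 0
      H-L′ = hub-injective (begin
        hub (H L′)   ≡⟨ w-even L′ ⟨
        w (L′ + L′)  ≡⟨ cong w L≡2L′ ⟨
        w L          ≡⟨ cong toV (periodic 0) ⟩
        w 0          ≡⟨ w-even 0 ⟩
        hub (H 0)    ∎)
        where open ≡-Reasoning
      k∣L′d : k ∣ L′ * d
      k∣L′d = shift-fixed⇒∣ (L′ * d) (H 0) (trans (sym (orbit d moves L′)) H-L′)
      k∣L′ : k ∣ L′
      k∣L′ = ∣-direction L′ d∈ k∣L′d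
      2k≤L : k + k ≤ L
      2k≤L = subst (k + k ≤_) (sym L≡2L′) (+-mono-≤ (∣⇒≤ k∣L′) (∣⇒≤ k∣L′))
      H-k : H k ≡ H 0
      H-k = trans (orbit d moves k) (trans (cong (λ e → shift e (H 0)) (*-comm k d)) (shift-multiple d (H 0)))
      L≤2k : L ≤ k + k
      L≤2k = ∣⇒≤ (H-return 0 k (subst (λ x → H x ≡ H 0) (sym (+-identityʳ k)) H-k))

    -- Either L = 4, or the walk never turns back and so winds around once.
    length : L ≡ 4 ⊎ L ≡ k + k
    length with L ≟ 4
    ... | yes L≡4 = inj₁ L≡4
    ... | no  L≢4 with H-moves 0
    ... | inj₁ forward  = inj₂ (closes 1 (inj₁ refl) (steady L≢4 1 K prev-next H-moves forward))
    ... | inj₂ backward = inj₂ (closes K (inj₂ refl) (steady L≢4 K 1 next-prev (swap ∘ H-moves) backward))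

  -- A walk may start at a group vertex; then start it one step later.
  walk-length : ∀ {L} → 3 ≤ L → CyclicWalk G L → L ≡ 4 ⊎ L ≡ k + k
  walk-length 3≤L W with isHub (toV (CyclicWalk.at W 0)) in start
  ... | true  = HubWalk.length 3≤L W start
  ... | false = HubWalk.length 3≤L (later W) (trans (isHub-flips _ _ (CyclicWalk.step W 0)) (cong not start))

  cycle-length : ∀ L → HasCycleOfLength G L → L ≡ 4 ⊎ L ≡ k + k
  cycle-length L@(suc (suc (suc _))) cycle = walk-length (s≤s (s≤s (s≤s z≤n))) (cycle⇒walk G L cycle)

0≤1 : 0ℚ ≤ℚ 1ℚ
0≤1 = ℚ.<⇒≤ (ℚ.positive⁻¹ 1ℚ)

ι : ℕ → ℚ
ι zero    = 0ℚ
ι (suc n) = 1ℚ +ℚ ι n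

ι-+ : ∀ a b → ι (a + b) ≡ ι a +ℚ ι b
ι-+ zero    b = sym (ℚ.+-identityˡ (ι b))
ι-+ (suc a) b = trans (cong (1ℚ +ℚ_) (ι-+ a b)) (sym (ℚ.+-assoc 1ℚ (ι a) (ι b)))

ι-nonneg : ∀ a → 0ℚ ≤ℚ ι a
ι-nonneg zero    = ℚ.≤-refl
ι-nonneg (suc a) = subst (_≤ℚ 1ℚ +ℚ ι a) (ℚ.+-identityˡ 0ℚ) (ℚ.+-mono-≤ 0≤1 (ι-nonneg a))

ι-suc≢0 : ∀ a → ι (suc a) ≢ 0ℚ
ι-suc≢0 a ι≡0 = ℚ.<-irrefl (sym ι≡0) (subst (_<ℚ 1ℚ +ℚ ι a) (ℚ.+-identityˡ 0ℚ)
                                       (ℚ.+-mono-<-≤ (ℚ.positive⁻¹ 1ℚ) (ι-nonneg a)))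

ι≢0 : ∀ {n} → 1 ≤ n → ι n ≢ 0ℚ
ι≢0 {suc n} _ = ι-suc≢0 n

+ℚ-cancelˡ : ∀ a {b c} → a +ℚ b ≡ a +ℚ c → b ≡ c
+ℚ-cancelˡ a = ∙-cancelˡ a _ _

*ℚ-cancelˡ : ∀ c {a b} → c ≢ 0ℚ → c *ℚ a ≡ c *ℚ b → a ≡ b
*ℚ-cancelˡ c {a} {b} c≢0 ca≡cb = begin
  a                    ≡⟨ ℚ.*-identityˡ a ⟨
  1ℚ *ℚ a              ≡⟨ cong (_*ℚ a) (ℚ.*-inverseˡ c) ⟨
  1/ c *ℚ c *ℚ a       ≡⟨ ℚ.*-assoc (1/ c) c a ⟩
  1/ c *ℚ (c *ℚ a)     ≡⟨ cong (1/ c *ℚ_) ca≡cb ⟩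
  1/ c *ℚ (c *ℚ b)     ≡⟨ ℚ.*-assoc (1/ c) c b ⟨
  1/ c *ℚ c *ℚ b       ≡⟨ cong (_*ℚ b) (ℚ.*-inverseˡ c) ⟩
  1ℚ *ℚ b              ≡⟨ ℚ.*-identityˡ b ⟩
  b                    ∎
  where
  open ≡-Reasoning
  instance
    c-nonZero : NonZeroℚ c
    c-nonZero = ≢-nonZero c≢0

*ℚ-cancelˡ-or-zero : ∀ c {a b} → c *ℚ a ≡ c *ℚ b → c ≡ 0ℚ ⊎ a ≡ b
*ℚ-cancelˡ-or-zero c ca≡cb with c ≟ℚ 0ℚ
... | yes c≡0 = inj₁ c≡0
... | no  c≢0 = inj₂ (*ℚ-cancelˡ c c≢0 ca≡cb)

*ℚ-ι-suc≡0 : ∀ t b → t *ℚ ι (suc b) ≡ 0ℚ → t ≡ 0ℚ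
*ℚ-ι-suc≡0 t b t·ι≡0 = *ℚ-cancelˡ (ι (suc b)) (ι-suc≢0 b)
  (trans (ℚ.*-comm (ι (suc b)) t) (trans t·ι≡0 (sym (ℚ.*-zeroʳ (ι (suc b))))))

nonneg-+≤0 : ∀ {a b} → 0ℚ ≤ℚ a → 0ℚ ≤ℚ b → a +ℚ b ≤ℚ 0ℚ → a ≡ 0ℚ × b ≡ 0ℚ
nonneg-+≤0 {a} {b} 0≤a 0≤b a+b≤0 =
  ℚ.≤-antisym (ℚ.≤-trans (subst (_≤ℚ a +ℚ b) (ℚ.+-identityʳ a) (ℚ.+-monoʳ-≤ a 0≤b)) a+b≤0) 0≤a ,
  ℚ.≤-antisym (ℚ.≤-trans (subst (_≤ℚ a +ℚ b) (ℚ.+-identityˡ b) (ℚ.+-monoˡ-≤ b 0≤a)) a+b≤0) 0≤b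

nonneg≡nonpos : ∀ {a b} → 0ℚ ≤ℚ a → 0ℚ ≤ℚ b → a ≡ -ℚ b → a ≡ 0ℚ × b ≡ 0ℚ
nonneg≡nonpos {a} {b} 0≤a 0≤b a≡-b = nonneg-+≤0 0≤a 0≤b (ℚ.≤-reflexive (begin
  a +ℚ b       ≡⟨ cong (_+ℚ b) a≡-b ⟩
  -ℚ b +ℚ b    ≡⟨ ℚ.+-inverseˡ b ⟩
  0ℚ           ∎))
  where open ≡-Reasoning

*ℚ-nonneg : ∀ {a b} → 0ℚ ≤ℚ a → 0ℚ ≤ℚ b → 0ℚ ≤ℚ a *ℚ b
*ℚ-nonneg {a} {b} 0≤a 0≤b =
  subst (_≤ℚ a *ℚ b) (ℚ.*-zeroˡ b) (ℚ.*-monoʳ-≤-nonNeg b {{nonNegative 0≤b}} 0≤a)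

neg-+-cancel : ∀ a b → -ℚ a +ℚ (a +ℚ b) ≡ b
neg-+-cancel a b = trans (sym (ℚ.+-assoc (-ℚ a) a b)) (trans (cong (_+ℚ b) (ℚ.+-inverseˡ a)) (ℚ.+-identityˡ b))

+ℚ-cancelˡ-≤ : ∀ a {b c} → a +ℚ b ≤ℚ a +ℚ c → b ≤ℚ c
+ℚ-cancelˡ-≤ a {b} {c} a+b≤a+c =
  subst₂ _≤ℚ_ (neg-+-cancel a b) (neg-+-cancel a c) (ℚ.+-monoʳ-≤ (-ℚ a) a+b≤a+c)

top-of-unit : ∀ q {u v} → u ≤ℚ 1ℚ → 0ℚ ≤ℚ v → u ≡ ι (suc q) +ℚ v → q ≡ 0 × u ≡ 1ℚ × v ≡ 0ℚ
top-of-unit q {u} {v} u≤1 0≤v u≡ = q≡0 q (proj₁ zeros) , u≡1 , proj₂ zeros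
  where
  1+ιq+v≤1+0 : 1ℚ +ℚ (ι q +ℚ v) ≤ℚ 1ℚ +ℚ 0ℚ
  1+ιq+v≤1+0 = subst₂ _≤ℚ_ (trans u≡ (ℚ.+-assoc 1ℚ (ι q) v)) (sym (ℚ.+-identityʳ 1ℚ)) u≤1

  zeros : ι q ≡ 0ℚ × v ≡ 0ℚ
  zeros = nonneg-+≤0 (ι-nonneg q) 0≤v (+ℚ-cancelˡ-≤ 1ℚ 1+ιq+v≤1+0)

  q≡0 : ∀ q → ι q ≡ 0ℚ → q ≡ 0
  q≡0 zero     _    = refl
  q≡0 (suc q′) ι≡0 = ⊥-elim (ι-suc≢0 q′ ι≡0)

  u≡1 : u ≡ 1ℚ
  u≡1 = begin
    u                           ≡⟨ u≡ ⟩
    (1ℚ +ℚ ι q) +ℚ v            ≡⟨ cong₂ (λ a b → (1ℚ +ℚ a) +ℚ b) (proj₁ zeros) (proj₂ zeros) ⟩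
    (1ℚ +ℚ 0ℚ) +ℚ 0ℚ            ≡⟨ ℚ.+-identityʳ (1ℚ +ℚ 0ℚ) ⟩
    1ℚ +ℚ 0ℚ                    ≡⟨ ℚ.+-identityʳ 1ℚ ⟩
    1ℚ                          ∎
    where open ≡-Reasoning

unit-band : ∀ p q {u v} → 0ℚ ≤ℚ u → u ≤ℚ 1ℚ → 0ℚ ≤ℚ v → v ≤ℚ 1ℚ → ι p +ℚ u ≡ ι q +ℚ v →
            (p ≡ q × u ≡ v) ⊎ (p ≡ suc q × u ≡ 0ℚ × v ≡ 1ℚ) ⊎ (q ≡ suc p × u ≡ 1ℚ × v ≡ 0ℚ)
unit-band zero    zero    _   _   _   _   same = inj₁ (refl , +ℚ-cancelˡ 0ℚ same)
unit-band zero    (suc q) {u} {v} _ u≤1 0≤v _ same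
  with top-of-unit q u≤1 0≤v (trans (sym (ℚ.+-identityˡ u)) same)
... | refl , u≡1 , v≡0 = inj₂ (inj₂ (refl , u≡1 , v≡0))
unit-band (suc p) zero    {u} {v} 0≤u _ _ v≤1 same
  with top-of-unit p v≤1 0≤u (trans (sym (ℚ.+-identityˡ v)) (sym same))
... | refl , v≡1 , u≡0 = inj₂ (inj₁ (refl , u≡0 , v≡1))
unit-band (suc p) (suc q) {u} {v} 0≤u u≤1 0≤v v≤1 same
  with unit-band p q 0≤u u≤1 0≤v v≤1 (+ℚ-cancelˡ 1ℚ (begin
    1ℚ +ℚ (ι p +ℚ u)   ≡⟨ ℚ.+-assoc 1ℚ (ι p) u ⟨
    ι (suc p) +ℚ u     ≡⟨ same ⟩
    ι (suc q) +ℚ v     ≡⟨ ℚ.+-assoc 1ℚ (ι q) v ⟩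
    1ℚ +ℚ (ι q +ℚ v)   ∎))
  where open ≡-Reasoning
... | inj₁ (p≡q , u≡v)                 = inj₁ (cong suc p≡q , u≡v)
... | inj₂ (inj₁ (p≡q⁺ , u≡0 , v≡1))  = inj₂ (inj₁ (cong suc p≡q⁺ , u≡0 , v≡1))
... | inj₂ (inj₂ (q≡p⁺ , u≡1 , v≡0))  = inj₂ (inj₂ (cong suc q≡p⁺ , u≡1 , v≡0))

ι-injective : ∀ {a b} → ι a ≡ ι b → a ≡ b
ι-injective {a} {b} ιa≡ιb
  with unit-band a b ℚ.≤-refl 0≤1 ℚ.≤-refl 0≤1 (cong₂ _+ℚ_ ιa≡ιb refl)
... | inj₁ (a≡b , _)            = a≡b
... | inj₂ (inj₁ (_ , _ , 0≡1)) = ⊥-elim (ℚ.<-irrefl 0≡1 (ℚ.positive⁻¹ 1ℚ))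
... | inj₂ (inj₂ (_ , 0≡1 , _)) = ⊥-elim (ℚ.<-irrefl 0≡1 (ℚ.positive⁻¹ 1ℚ))

-- The unit interval [ι p, ι (p + 1)] with p = level o + 2β is traversed
-- upwards (o = false) or downwards (o = true) by a parameter t ∈ [0, 1].
level : Bool → ℕ
level false = 0
level true  = 1

along : Bool → ℚ → ℚ
along false t = t
along true  t = 1ℚ -ℚ t

height : ℕ → Bool → ℚ → ℚ
height β o t = ι (level o + (β + β)) +ℚ along o t

param : Bool → ℚ
param false = 0ℚ
param true  = 1ℚ

param-∈ : ∀ b → 0ℚ ≤ℚ param b × param b ≤ℚ 1ℚ
param-∈ false = ℚ.≤-refl , 0≤1
param-∈ true  = 0≤1 , ℚ.≤-refl

along-∈ : ∀ o {t} → 0ℚ ≤ℚ t → t ≤ℚ 1ℚ → 0ℚ ≤ℚ along o t × along o t ≤ℚ 1ℚ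
along-∈ false 0≤t t≤1 = 0≤t , t≤1
along-∈ true {t} 0≤t t≤1 =
  subst (_≤ℚ 1ℚ -ℚ t) (ℚ.+-inverseʳ t) (ℚ.+-monoˡ-≤ (-ℚ t) t≤1) ,
  subst (1ℚ -ℚ t ≤ℚ_) (ℚ.+-identityʳ 1ℚ) (ℚ.+-monoʳ-≤ 1ℚ (ℚ.neg-antimono-≤ 0≤t))

along-injective : ∀ o {t s} → along o t ≡ along o s → t ≡ s
along-injective false eq = eq
along-injective true  eq = ℚ.neg-injective (+ℚ-cancelˡ 1ℚ eq)

along≡0 : ∀ o {t} → along o t ≡ 0ℚ → t ≡ param o
along≡0 false t≡0   = t≡0
along≡0 true  1-t≡0 = sym (x∙y⁻¹≈ε⇒x≈y _ _ 1-t≡0)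

along≡1 : ∀ o {t} → along o t ≡ 1ℚ → t ≡ param (not o)
along≡1 false t≡1   = t≡1
along≡1 true  1-t≡1 = ⁻¹-injective (trans (+ℚ-cancelˡ 1ℚ (trans 1-t≡1 (sym (ℚ.+-identityʳ 1ℚ)))) (sym ε⁻¹≈ε))

same-level : ∀ o o′ β β′ → level o + (β + β) ≡ level o′ + (β′ + β′) → o ≡ o′ × β ≡ β′
same-level false false β β′ eq = refl , half-injective β β′ eq
same-level true  true  β β′ eq = refl , half-injective β β′ (suc-injective eq)
same-level false true  β β′ eq = ⊥-elim (double≢odd β β′ eq)
same-level true  false β β′ eq = ⊥-elim (double≢odd β′ β (sym eq))

next-level : ∀ o o′ β β′ → level o + (β + β) ≡ suc (level o′ + (β′ + β′)) → o′ ≡ not o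
next-level false false β β′ eq = ⊥-elim (double≢odd β β′ eq)
next-level true  true  β β′ eq = ⊥-elim (double≢odd β β′ (suc-injective eq))
next-level false true  β β′ eq = refl
next-level true  false β β′ eq = refl

not-flip : ∀ {o o′} → o′ ≡ not o → not o′ ≡ o
not-flip {o} refl = not-involutive o

band-meet : ∀ β β′ o o′ {t s} → 0ℚ ≤ℚ t → t ≤ℚ 1ℚ → 0ℚ ≤ℚ s → s ≤ℚ 1ℚ →
            height β o t ≡ height β′ o′ s →
            (Σ Bool λ b → t ≡ param b × s ≡ param b) ⊎ (β ≡ β′ × o ≡ o′ × t ≡ s)
band-meet β β′ o o′ 0≤t t≤1 0≤s s≤1 same
  with along-∈ o 0≤t t≤1 | along-∈ o′ 0≤s s≤1
... | 0≤u , u≤1 | 0≤v , v≤1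
  with unit-band (level o + (β + β)) (level o′ + (β′ + β′)) 0≤u u≤1 0≤v v≤1 same
... | inj₁ (p≡q , u≡v) with same-level o o′ β β′ p≡q
...   | refl , β≡β′ = inj₂ (β≡β′ , refl , along-injective o u≡v)
band-meet β β′ o o′ _ _ _ _ _ | _ | _ | inj₂ (inj₁ (p≡q⁺ , u≡0 , v≡1)) =
  inj₁ (o , along≡0 o u≡0 , trans (along≡1 o′ v≡1) (cong param (not-flip (next-level o o′ β β′ p≡q⁺))))
band-meet β β′ o o′ _ _ _ _ _ | _ | _ | inj₂ (inj₂ (q≡p⁺ , u≡1 , v≡0)) =
  inj₁ (o′ , trans (along≡1 o u≡1) (cong param (not-flip (next-level o′ o β′ β q≡p⁺))) , along≡0 o′ v≡0)

lerp : Point → Point → ℚ → Point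
lerp (px , py) (qx , qy) t = (px +ℚ t *ℚ (qx -ℚ px) , py +ℚ t *ℚ (qy -ℚ py))

onSegment⇒lerp : ∀ x P Q → OnSegment x P Q → Σ ℚ λ t → 0ℚ ≤ℚ t × t ≤ℚ 1ℚ × x ≡ lerp P Q t
onSegment⇒lerp (x , y) (px , py) (qx , qy) (t , 0≤t , t≤1 , x≡ , y≡) = t , 0≤t , t≤1 , cong₂ _,_ x≡ y≡

lerp-flip : ∀ P Q t → lerp P Q t ≡ lerp Q P (1ℚ -ℚ t)
lerp-flip (px , py) (qx , qy) t = cong₂ _,_ (flip px qx t) (flip py qy t)
  where
  flip : ∀ p q t → p +ℚ t *ℚ (q -ℚ p) ≡ q +ℚ (1ℚ -ℚ t) *ℚ (p -ℚ q)
  flip = solve 3 (λ p q t → p :+ t :* (q :- p) := q :+ (con 1ℚ :- t) :* (p :- q)) refl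

lerp-param : ∀ P Q b → lerp P Q (param b) ≡ (if b then Q else P)
lerp-param (px , py) (qx , qy) false = cong₂ _,_ (at0 px qx) (at0 py qy)
  where
  at0 : ∀ p q → p +ℚ 0ℚ *ℚ (q -ℚ p) ≡ p
  at0 = solve 2 (λ p q → p :+ con 0ℚ :* (q :- p) := p) refl
lerp-param (px , py) (qx , qy) true = cong₂ _,_ (at1 px qx) (at1 py qy)
  where
  at1 : ∀ p q → p +ℚ 1ℚ *ℚ (q -ℚ p) ≡ q
  at1 = solve 2 (λ p q → p :+ con 1ℚ :* (q :- p) := q) refl

module Drawing (K m : ℕ) (1≤K : 1 ≤ K) where
  open Construction K m

  -- Group i is drawn to the right of the vertical axis of hubs if i < K,
  -- and the last group K to its left.
  data Side (i : Fin k) : Set where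
    right : toℕ i < K → Side i
    left  : toℕ i ≡ K → Side i

  side : ∀ i → Side i
  side i with toℕ i <? K
  ... | yes i<K = right i<K
  ... | no  i≮K = left (≤-antisym (≤-pred (Fin.toℕ<n i)) (≮⇒≥ i≮K))

  -- Hub h sits at (0, 2h); grp i j at (j + 1, 2i + 1) if i < K and at (-(j + 1), K) if i = K.
  grpPos : ∀ {i} → Side i → Fin m → Point
  grpPos {i} (right _) j = ι (suc (toℕ j)) , ι (suc (toℕ i + toℕ i))
  grpPos     (left _)  j = -ℚ ι (suc (toℕ j)) , ι K

  pos : V → Point
  pos (hub h)   = 0ℚ , ι (toℕ h + toℕ h)
  pos (grp i j) = grpPos (side i) j

  data Edge : Set where
    edge : Fin k → Bool → Fin m → Edge

  endpoint : Bool → Edge → V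
  endpoint false (edge i e j) = hub (end e i)
  endpoint true  (edge i e j) = grp i j

  segment : Edge → ℚ → Point
  segment ε = lerp (pos (endpoint false ε)) (pos (endpoint true ε))

  -- In suitable coordinates every edge of a side is a unit interval: the point
  -- with parameter t on edge (i, e, j) has abscissa ± t (j + 1) and ordinate a
  -- multiple of height β o t, as expressed by  chartPoint (side i) e j t.
  sign : ∀ {i} → Side i → ℚ → ℚ
  sign (right _) x = x
  sign (left _)  x = -ℚ x

  scale : ∀ {i} → Side i → ℚ
  scale (right _) = 1ℚ
  scale (left _)  = ι K

  base : ∀ {i} → Side i → ℕ
  base {i} (right _) = toℕ i
  base     (left _)  = 0

  orient : ∀ {i} → Side i → Bool → Bool
  orient (right _) e = e
  orient (left _)  e = not e

  chartPoint : ∀ {i} → Side i → Bool → Fin m → ℚ → Point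
  chartPoint σ e j t = sign σ (t *ℚ ι (suc (toℕ j))) , scale σ *ℚ height (base σ) (orient σ e) t

  hub-height : ∀ {h : Fin k} n → toℕ h ≡ n → ι (toℕ h + toℕ h) ≡ ι (n + n)
  hub-height n = cong (λ a → ι (a + a))

  -- The coordinate identities behind the charts (J = j + 1, Y = 2i, A = K).
  x-right : ∀ t J → 0ℚ +ℚ t *ℚ (J -ℚ 0ℚ) ≡ t *ℚ J
  x-right = solve 2 (λ t J → con 0ℚ :+ t :* (J :- con 0ℚ) := t :* J) refl

  x-left : ∀ t J → 0ℚ +ℚ t *ℚ (-ℚ J -ℚ 0ℚ) ≡ -ℚ (t *ℚ J)
  x-left = solve 2 (λ t J → con 0ℚ :+ t :* ((:- J) :- con 0ℚ) := :- (t :* J)) refl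

  y-right-lower : ∀ t Y → Y +ℚ t *ℚ ((1ℚ +ℚ Y) -ℚ Y) ≡ 1ℚ *ℚ (Y +ℚ t)
  y-right-lower = solve 2 (λ t Y → Y :+ t :* ((con 1ℚ :+ Y) :- Y) := con 1ℚ :* (Y :+ t)) refl

  y-right-upper : ∀ t Y → (1ℚ +ℚ (1ℚ +ℚ Y)) +ℚ t *ℚ ((1ℚ +ℚ Y) -ℚ (1ℚ +ℚ (1ℚ +ℚ Y)))
                          ≡ 1ℚ *ℚ ((1ℚ +ℚ Y) +ℚ (1ℚ -ℚ t))
  y-right-upper = solve 2 (λ t Y → (con 1ℚ :+ (con 1ℚ :+ Y)) :+ t :* ((con 1ℚ :+ Y) :- (con 1ℚ :+ (con 1ℚ :+ Y)))
                                   := con 1ℚ :* ((con 1ℚ :+ Y) :+ (con 1ℚ :- t))) refl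

  y-left-upper : ∀ t A → (A +ℚ A) +ℚ t *ℚ (A -ℚ (A +ℚ A)) ≡ A *ℚ ((1ℚ +ℚ 0ℚ) +ℚ (1ℚ -ℚ t))
  y-left-upper = solve 2 (λ t A → (A :+ A) :+ t :* (A :- (A :+ A))
                                  := A :* ((con 1ℚ :+ con 0ℚ) :+ (con 1ℚ :- t))) refl

  y-left-lower : ∀ t A → 0ℚ +ℚ t *ℚ (A -ℚ 0ℚ) ≡ A *ℚ (0ℚ +ℚ t)
  y-left-lower = solve 2 (λ t A → con 0ℚ :+ t :* (A :- con 0ℚ) := A :* (con 0ℚ :+ t)) refl

  onGroupEdge : ∀ {i} → Side i → Bool → Fin m → ℚ → Point
  onGroupEdge {i} σ e j = lerp (pos (hub (end e i))) (grpPos σ j)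

  chart-right : ∀ {i} (i<K : toℕ i < K) e j t → onGroupEdge (right i<K) e j t ≡ chartPoint (right i<K) e j t
  chart-right {i} i<K false j t =
    cong₂ _,_ (x-right t (ι (suc (toℕ j)))) (y-right-lower t (ι (toℕ i + toℕ i)))
  chart-right {i} i<K true  j t = cong₂ _,_ (x-right t (ι (suc (toℕ j)))) (begin
    Yₕ +ℚ t *ℚ (ι (suc (a + a)) -ℚ Yₕ)
      ≡⟨ cong (λ y → y +ℚ t *ℚ (ι (suc (a + a)) -ℚ y)) Yₕ≡ ⟩
    (1ℚ +ℚ (1ℚ +ℚ ι (a + a))) +ℚ t *ℚ ((1ℚ +ℚ ι (a + a)) -ℚ (1ℚ +ℚ (1ℚ +ℚ ι (a + a))))
      ≡⟨ y-right-upper t (ι (a + a)) ⟩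
    1ℚ *ℚ ((1ℚ +ℚ ι (a + a)) +ℚ (1ℚ -ℚ t)) ∎)
    where
    open ≡-Reasoning
    a : ℕ
    a = toℕ i
    Yₕ : ℚ
    Yₕ = ι (toℕ (next i) + toℕ (next i))
    Yₕ≡ : Yₕ ≡ 1ℚ +ℚ (1ℚ +ℚ ι (a + a))
    Yₕ≡ = trans (hub-height (suc a) (toℕ-next-< i i<K)) (cong (λ n → 1ℚ +ℚ ι n) (+-suc a a))

  chart-left : ∀ {i} (i≡K : toℕ i ≡ K) e j t → onGroupEdge (left i≡K) e j t ≡ chartPoint (left i≡K) e j t
  chart-left {i} i≡K false j t = cong₂ _,_ (x-left t (ι (suc (toℕ j)))) (begin
    ι (toℕ i + toℕ i) +ℚ t *ℚ (ι K -ℚ ι (toℕ i + toℕ i))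
      ≡⟨ cong (λ y → y +ℚ t *ℚ (ι K -ℚ y)) (trans (hub-height K i≡K) (ι-+ K K)) ⟩
    (ι K +ℚ ι K) +ℚ t *ℚ (ι K -ℚ (ι K +ℚ ι K))
      ≡⟨ y-left-upper t (ι K) ⟩
    ι K *ℚ ((1ℚ +ℚ 0ℚ) +ℚ (1ℚ -ℚ t)) ∎)
    where open ≡-Reasoning
  chart-left {i} i≡K true  j t = cong₂ _,_ (x-left t (ι (suc (toℕ j)))) (begin
    ι (toℕ (next i) + toℕ (next i)) +ℚ t *ℚ (ι K -ℚ ι (toℕ (next i) + toℕ (next i)))
      ≡⟨ cong (λ y → y +ℚ t *ℚ (ι K -ℚ y)) (hub-height 0 (toℕ-next-last i i≡K)) ⟩
    0ℚ +ℚ t *ℚ (ι K -ℚ 0ℚ)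
      ≡⟨ y-left-lower t (ι K) ⟩
    ι K *ℚ (0ℚ +ℚ t) ∎)
    where open ≡-Reasoning

  chart : ∀ i e j t → segment (edge i e j) t ≡ chartPoint (side i) e j t
  chart i e j t with side i
  ... | right i<K = chart-right i<K e j t
  ... | left  i≡K = chart-left i≡K e j t

  edge-≡ : ∀ {i i′ e e′ j j′} → i ≡ i′ → e ≡ e′ → j ≡ j′ → edge i e j ≡ edge i′ e′ j′
  edge-≡ refl refl refl = refl

  Meet : ℚ → ℚ → Edge → Edge → Set
  Meet t s ε ε′ = (Σ Bool λ b → t ≡ param b × s ≡ param b) ⊎ ε ≡ ε′

  same-slot : ∀ (j j′ : Fin m) {t s} → t ≡ s → t *ℚ ι (suc (toℕ j)) ≡ s *ℚ ι (suc (toℕ j′)) →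
              (Σ Bool λ b → t ≡ param b × s ≡ param b) ⊎ j ≡ j′
  same-slot j j′ {t} refl tJ≡tJ′ with *ℚ-cancelˡ-or-zero t tJ≡tJ′
  ... | inj₁ t≡0  = inj₁ (false , t≡0 , t≡0)
  ... | inj₂ J≡J′ = inj₂ (Fin.toℕ-injective (suc-injective (ι-injective J≡J′)))

  opposite-sides : ∀ (j j′ : Fin m) {t s} → 0ℚ ≤ℚ t → 0ℚ ≤ℚ s →
                   t *ℚ ι (suc (toℕ j)) ≡ -ℚ (s *ℚ ι (suc (toℕ j′))) → t ≡ 0ℚ × s ≡ 0ℚ
  opposite-sides j j′ {t} {s} 0≤t 0≤s eq
    with nonneg≡nonpos (*ℚ-nonneg 0≤t (ι-nonneg (suc (toℕ j)))) (*ℚ-nonneg 0≤s (ι-nonneg (suc (toℕ j′)))) eq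
  ... | tJ≡0 , sJ′≡0 = *ℚ-ι-suc≡0 t (toℕ j) tJ≡0 , *ℚ-ι-suc≡0 s (toℕ j′) sJ′≡0

  -- Comparing two chart points: the two sides only meet at hubs; on one side
  -- the ordinates fix the unit interval and the parameter (band-meet), and
  -- then the abscissae fix the slot.
  meet : ∀ {i i′} (σ : Side i) (σ′ : Side i′) e e′ j j′ {t s} →
         0ℚ ≤ℚ t → t ≤ℚ 1ℚ → 0ℚ ≤ℚ s → s ≤ℚ 1ℚ →
         chartPoint σ e j t ≡ chartPoint σ′ e′ j′ s → Meet t s (edge i e j) (edge i′ e′ j′)
  meet {i} {i′} (right _) (right _) e e′ j j′ {t} {s} 0≤t t≤1 0≤s s≤1 same
    with band-meet (toℕ i) (toℕ i′) e e′ 0≤t t≤1 0≤s s≤1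
           (subst₂ _≡_ (ℚ.*-identityˡ (height (toℕ i) e t)) (ℚ.*-identityˡ (height (toℕ i′) e′ s)) (cong proj₂ same))
  ... | inj₁ ends = inj₁ ends
  ... | inj₂ (i≡i′ , e≡e′ , t≡s) with same-slot j j′ t≡s (cong proj₁ same)
  ...   | inj₁ ends = inj₁ ends
  ...   | inj₂ j≡j′ = inj₂ (edge-≡ (Fin.toℕ-injective i≡i′) e≡e′ j≡j′)
  meet {i} {i′} (left i≡K) (left i′≡K) e e′ j j′ 0≤t t≤1 0≤s s≤1 same
    with band-meet 0 0 (not e) (not e′) 0≤t t≤1 0≤s s≤1 (*ℚ-cancelˡ (ι K) (ι≢0 1≤K) (cong proj₂ same))
  ... | inj₁ ends = inj₁ ends
  ... | inj₂ (_ , ¬e≡¬e′ , t≡s) with same-slot j j′ t≡s (ℚ.neg-injective (cong proj₁ same))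
  ...   | inj₁ ends = inj₁ ends
  ...   | inj₂ j≡j′ = inj₂ (edge-≡ (Fin.toℕ-injective (trans i≡K (sym i′≡K))) (not-injective ¬e≡¬e′) j≡j′)
  meet (right _) (left _) e e′ j j′ {t} {s} 0≤t _ 0≤s _ same =
    let t≡0 , s≡0 = opposite-sides j j′ {t} {s} 0≤t 0≤s (cong proj₁ same) in inj₁ (false , t≡0 , s≡0)
  meet (left _) (right _) e e′ j j′ {t} {s} 0≤t _ 0≤s _ same =
    let s≡0 , t≡0 = opposite-sides j′ j {s} {t} 0≤s 0≤t (sym (cong proj₁ same)) in inj₁ (false , t≡0 , s≡0)

  pos-injective : ∀ u v → pos u ≡ pos v → u ≡ v
  pos-injective (hub h) (hub h′) same =
    cong hub (Fin.toℕ-injective (half-injective (toℕ h) (toℕ h′) (ι-injective (cong proj₂ same))))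
  pos-injective (hub h) (grp i j) same = ⊥-elim (off-axis (side i) j (sym (cong proj₁ same)))
    where
    off-axis : ∀ {i} (σ : Side i) j → proj₁ (grpPos σ j) ≢ 0ℚ
    off-axis (right _) j = ι-suc≢0 (toℕ j)
    off-axis (left _)  j = ι-suc≢0 (toℕ j) ∘ ℚ.neg-injective
  pos-injective (grp i j) (hub h) same = sym (pos-injective (hub h) (grp i j) (sym same))
  pos-injective (grp i j) (grp i′ j′) same = grp-≡ (side i) (side i′) same
    where
    slot-≡ : ∀ {j j′ : Fin m} → ι (suc (toℕ j)) ≡ ι (suc (toℕ j′)) → j ≡ j′
    slot-≡ = Fin.toℕ-injective ∘ suc-injective ∘ ι-injective

    grp-≡ : ∀ {i i′ j j′} (σ : Side i) (σ′ : Side i′) → grpPos σ j ≡ grpPos σ′ j′ → grp i j ≡ grp i′ j′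
    grp-≡ {i} {i′} (right _) (right _) same = cong₂ grp
      (Fin.toℕ-injective (half-injective (toℕ i) (toℕ i′) (suc-injective (ι-injective (cong proj₂ same)))))
      (slot-≡ (cong proj₁ same))
    grp-≡ (left i≡K) (left i′≡K) same = cong₂ grp
      (Fin.toℕ-injective (trans i≡K (sym i′≡K))) (slot-≡ (ℚ.neg-injective (cong proj₁ same)))
    grp-≡ {j = j} {j′} (right _) (left _) same = ⊥-elim (ι-suc≢0 (toℕ j) (proj₁
      (nonneg≡nonpos (ι-nonneg (suc (toℕ j))) (ι-nonneg (suc (toℕ j′))) (cong proj₁ same))))
    grp-≡ {j = j} {j′} (left _) (right _) same = ⊥-elim (ι-suc≢0 (toℕ j′) (proj₁
      (nonneg≡nonpos (ι-nonneg (suc (toℕ j′))) (ι-nonneg (suc (toℕ j))) (sym (cong proj₁ same)))))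

  Ends : Edge → V → V → Set
  Ends ε u v = (u ≡ endpoint false ε × v ≡ endpoint true ε) ⊎ (u ≡ endpoint true ε × v ≡ endpoint false ε)

  edge-of : ∀ u v → adjV u v ≡ true → Σ Edge λ ε → Ends ε u v
  edge-of (hub h)   (grp i j) h∈i with isEnd-sound h i h∈i
  ... | e , refl = edge i e j , inj₁ (refl , refl)
  edge-of (grp i j) (hub h)   h∈i with isEnd-sound h i h∈i
  ... | e , refl = edge i e j , inj₂ (refl , refl)

  on-edge : ∀ ε {u v} x → Ends ε u v → OnSegment x (pos u) (pos v) →
            Σ ℚ λ t → 0ℚ ≤ℚ t × t ≤ℚ 1ℚ × x ≡ segment ε t
  on-edge ε x (inj₁ (refl , refl)) on = onSegment⇒lerp x (pos (endpoint false ε)) (pos (endpoint true ε)) on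
  on-edge ε x (inj₂ (refl , refl)) on with onSegment⇒lerp x (pos (endpoint true ε)) (pos (endpoint false ε)) on
  ... | t , 0≤t , t≤1 , x≡ =
    let 0≤1-t , 1-t≤1 = along-∈ true 0≤t t≤1
    in 1ℚ -ℚ t , 0≤1-t , 1-t≤1 , trans x≡ (lerp-flip (pos (endpoint true ε)) (pos (endpoint false ε)) t)

  segment-end : ∀ ε b → segment ε (param b) ≡ pos (endpoint b ε)
  segment-end ε false = lerp-param (pos (endpoint false ε)) (pos (endpoint true ε)) false
  segment-end ε true  = lerp-param (pos (endpoint false ε)) (pos (endpoint true ε)) true

  edges-meet : ∀ ε ε′ {t s} → 0ℚ ≤ℚ t → t ≤ℚ 1ℚ → 0ℚ ≤ℚ s → s ≤ℚ 1ℚ →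
               segment ε t ≡ segment ε′ s → (Σ Bool λ b → endpoint b ε ≡ endpoint b ε′ × segment ε t ≡ pos (endpoint b ε)) ⊎ ε ≡ ε′
  edges-meet (edge i e j) (edge i′ e′ j′) {t} {s} 0≤t t≤1 0≤s s≤1 same
    with meet (side i) (side i′) e e′ j j′ 0≤t t≤1 0≤s s≤1 (trans (sym (chart i e j t)) (trans same (chart i′ e′ j′ s)))
  ... | inj₂ ε≡ε′ = inj₂ ε≡ε′
  ... | inj₁ (b , refl , refl) = inj₁ (b , pos-injective _ _ (trans (sym (segment-end (edge i e j) b)) (trans same (segment-end (edge i′ e′ j′) b))) , segment-end (edge i e j) b)

  draw : Fin N → Point
  draw x = pos (toV x)

  endpoint-∈ : ∀ ε {a b} → Ends ε (toV a) (toV b) → ∀ e → fromV (endpoint e ε) ≡ a ⊎ fromV (endpoint e ε) ≡ b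
  endpoint-∈ ε (inj₁ (a≡ , b≡)) false = inj₁ (toV⁻¹ a≡)
  endpoint-∈ ε (inj₁ (a≡ , b≡)) true  = inj₂ (toV⁻¹ b≡)
  endpoint-∈ ε (inj₂ (a≡ , b≡)) false = inj₂ (toV⁻¹ b≡)
  endpoint-∈ ε (inj₂ (a≡ , b≡)) true  = inj₁ (toV⁻¹ a≡)

  same-ends : ∀ ε {a b c d} → Ends ε (toV a) (toV b) → Ends ε (toV c) (toV d) → SameEdge a b c d
  same-ends ε (inj₁ (a≡ , b≡)) (inj₁ (c≡ , d≡)) = inj₁ (toV-injective (trans a≡ (sym c≡)) , toV-injective (trans b≡ (sym d≡)))
  same-ends ε (inj₁ (a≡ , b≡)) (inj₂ (c≡ , d≡)) = inj₂ (toV-injective (trans a≡ (sym d≡)) , toV-injective (trans b≡ (sym c≡)))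
  same-ends ε (inj₂ (a≡ , b≡)) (inj₁ (c≡ , d≡)) = inj₂ (toV-injective (trans a≡ (sym d≡)) , toV-injective (trans b≡ (sym c≡)))
  same-ends ε (inj₂ (a≡ , b≡)) (inj₂ (c≡ , d≡)) = inj₁ (toV-injective (trans a≡ (sym c≡)) , toV-injective (trans b≡ (sym d≡)))

  crossing : ∀ a b c d → Adj G a b → Adj G c d → ¬ SameEdge a b c d →
             ∀ x → OnSegment x (draw a) (draw b) → OnSegment x (draw c) (draw d) →
             Σ (Fin N) λ v → (v ≡ a ⊎ v ≡ b) × (v ≡ c ⊎ v ≡ d) × x ≡ draw v
  crossing a b c d a~b c~d different x on₁ on₂
    with edge-of (toV a) (toV b) a~b | edge-of (toV c) (toV d) c~d
  ... | ε , ends | ε′ , ends′ with on-edge ε x ends on₁ | on-edge ε′ x ends′ on₂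
  ... | t , 0≤t , t≤1 , x≡ | s , 0≤s , s≤1 , x≡′
    with edges-meet ε ε′ {t} {s} 0≤t t≤1 0≤s s≤1 (trans (sym x≡) x≡′)
  ... | inj₂ refl = ⊥-elim (different (same-ends ε ends ends′))
  ... | inj₁ (e , common , at-end) =
    fromV (endpoint e ε) ,
    endpoint-∈ ε ends e ,
    subst (λ v → fromV v ≡ c ⊎ fromV v ≡ d) (sym common) (endpoint-∈ ε′ ends′ e) ,
    trans x≡ (trans at-end (cong pos (sym (toV-fromV (endpoint e ε)))))

  -- Every vertex is an endpoint of some edge (here m ≥ 1 is needed for the hubs).
  as-endpoint : 1 ≤ m → ∀ v → Σ Edge λ ε → Σ Bool λ e → v ≡ endpoint e ε
  as-endpoint 1≤m (hub h)   = edge h false (fromℕ< 1≤m) , false , refl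
  as-endpoint _   (grp i j) = edge i false j , true , refl

  avoiding : 1 ≤ m → ∀ w a b → Adj G a b → OnSegment (draw w) (draw a) (draw b) → w ≡ a ⊎ w ≡ b
  avoiding 1≤m w a b a~b on with edge-of (toV a) (toV b) a~b | as-endpoint 1≤m (toV w)
  ... | ε , ends | ε′ , e′ , w≡ with on-edge ε (draw w) ends on
  ... | t , 0≤t , t≤1 , w-at with param-∈ e′
  ... | 0≤p , p≤1
    with edges-meet ε ε′ {t} {param e′} 0≤t t≤1 0≤p p≤1
           (trans (sym w-at) (trans (cong pos w≡) (sym (segment-end ε′ e′))))
  ... | inj₂ refl = Sum.map (trans w≡end) (trans w≡end) (endpoint-∈ ε ends e′)
    where
    w≡end : w ≡ fromV (endpoint e′ ε)
    w≡end = sym (toV⁻¹ w≡)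
  ... | inj₁ (e , _ , at-end) = Sum.map (trans w≡end) (trans w≡end) (endpoint-∈ ε ends e)
    where
    w≡end : w ≡ fromV (endpoint e ε)
    w≡end = sym (toV⁻¹ (pos-injective (toV w) (endpoint e ε) (trans w-at at-end)))

  planar : 1 ≤ m → Planar G
  planar 1≤m = draw , avoiding 1≤m , crossing

odd-split : ∀ k → 3 ≤ k → k % 2 ≡ 1 → Σ ℕ λ K₂ → k ≡ suc (K₂ + K₂) × 1 ≤ K₂
odd-split k 3≤k k-odd with parity k
... | K₂ , inj₁ k≡2K₂ = ⊥-elim (0≢1+n (trans (sym even) k-odd))
  where
  even : k % 2 ≡ 0
  even = trans (cong (_% 2) (trans k≡2K₂ (cong (K₂ +_) (sym (+-identityʳ K₂))))) (n∣m⇒m%n≡0 _ 2 (m∣m*n K₂))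
... | zero   , inj₂ k≡1  = ⊥-elim (<⇒≱ 3≤k (subst (_≤ 2) (sym k≡1) (s≤s z≤n)))
... | suc K₂ , inj₂ k≡2K₂+1 = suc K₂ , k≡2K₂+1 , s≤s z≤n

-- With m = C K₂ + 1, there are (2K₂ + 1) m group vertices, while D + C ≤ 2m + C
-- colours, each used at most K₂ times, cover at most 2m K₂ + C K₂ < (2K₂ + 1) m of them.
too-few-colours : ∀ C K₂ D → D ≤ suc (C * K₂) + suc (C * K₂) →
                  ¬ suc (K₂ + K₂) * suc (C * K₂) ≤ (D + C) * K₂
too-few-colours C K₂ D D≤2m enough = <⇒≱ (n<1+n (C * K₂)) (+-cancelʳ-≤ ((m + m) * K₂) m (C * K₂) (begin
  m + (m + m) * K₂        ≡⟨ groups C K₂ ⟩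
  suc (K₂ + K₂) * m       ≤⟨ enough ⟩
  (D + C) * K₂            ≤⟨ *-monoˡ-≤ K₂ (+-monoˡ-≤ C D≤2m) ⟩
  (m + m + C) * K₂        ≡⟨ colours C K₂ ⟩
  C * K₂ + (m + m) * K₂   ∎))
  where
  open ≤-Reasoning
  m : ℕ
  m = suc (C * K₂)
  groups : ∀ C K₂ → suc (C * K₂) + (suc (C * K₂) + suc (C * K₂)) * K₂ ≡ suc (K₂ + K₂) * suc (C * K₂)
  groups = solve-∀
  colours : ∀ C K₂ → (suc (C * K₂) + suc (C * K₂) + C) * K₂ ≡ C * K₂ + (suc (C * K₂) + suc (C * K₂)) * K₂
  colours = solve-∀

mainTheorem2 : (S : ℕ → Set) → (∀ m → S m → 1 ≤ m) → ¬ S 4 →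
    (k : ℕ) → 3 ≤ k → k % 2 ≡ 1 → ¬ S (2 * k) →
    ¬ (Σ ℕ λ C → ∀ (G : Graph) → Planar G →
         (∀ L → S L → ¬ HasCycleOfLength G L) →
         SquareColourable G (Δ G + C))
mainTheorem2 S _ ¬S4 k 3≤k k-odd ¬S2k (C , colourable) with odd-split k 3≤k k-odd
... | K₂ , refl , 1≤K₂ =
  too-few-colours C K₂ (Δ G) (Δ-G 1≤m)
    (square-colouring-bound 1≤K K₂ refl (Δ G + C)
      (colourable G (Drawing.planar K m 1≤K 1≤m) allowed-cycles))
  where
  K m : ℕ
  K = K₂ + K₂
  m = suc (C * K₂)
  1≤K : 1 ≤ K
  1≤K = ≤-trans 1≤K₂ (m≤m+n K₂ K₂)
  1≤m : 1 ≤ m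
  1≤m = s≤s z≤n
  open Construction K m using (G; Δ-G; square-colouring-bound)
  allowed-cycles : ∀ L → S L → ¬ HasCycleOfLength G L
  allowed-cycles L S-L cycle with CycleLengths.cycle-length K m 1≤K L cycle
  ... | inj₁ L≡4  = ¬S4 (subst S L≡4 S-L)
  ... | inj₂ L≡2k = ¬S2k (subst S (trans L≡2k (cong (k +_) (sym (+-identityʳ k)))) S-L)
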